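{- Let $k\ge 2$ be an integer and let $\zeta_0,\dots,\zeta_{k-1}$ be the $k$ (distinct) complex roots of $A(x)=x^k-x^{k-1}-\dots-x-1$. Let $\mu$ be a complex number and let $(w_n)_{n\ge 0}$ be defined by $w_n=\mu^n$ for $0\le n\le k-1$ and $w_n=w_{n-1}+w_{n-2}+\dots+w_{n-k}$ for $n\ge k$. Then $w_n=\sum_{j=0}^{k-1}c_j\zeta_j^{\,n}$ for all $n\ge 0$, where: (i) if $\mu\ne 1$ and $\mu$ is not a root of $A$, $$c_j=\frac{\mu^{k+1}-2\mu^k+1}{(\mu-1)(\mu-\zeta_j)}\cdot\frac{\zeta_j-1}{(k+1)\zeta_j-2k}\cdot\frac{1}{\zeta_j^{\,k-1}};$$ (ii) if $\mu=1$, $$c_j=\frac{k-1}{(k+1)\zeta_j-2k}\cdot\frac{1}{\zeta_j^{\,k-1}}.$$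
   Context: The roots of $A(x)$ are known to be simple. -}

module Defs where

open import Level using (Level; _⊔_)
open import Data.Nat as ℕ using (ℕ; zero; suc)
open import Data.Fin as Fin using (Fin)
open import Data.Product using (_×_)
open import Relation.Nullary using (¬_)
open import Algebra.Bundles using (CommutativeRing)

ringℕ : ∀ {c ℓ} (R : CommutativeRing c ℓ) → ℕ → CommutativeRing.Carrier R
ringℕ R zero    = CommutativeRing.0# R
ringℕ R (suc n) = CommutativeRing._+_ R (CommutativeRing.1# R) (ringℕ R n)

-- The complex numbers ℂ are such a field; ℂ itself is not available in
-- agda-stdlib.
record CharZeroField (c ℓ : Level) : Set (Level.suc (c ⊔ ℓ)) where
  field
    commRing : CommutativeRing c ℓ
  open CommutativeRing commRing public hiding (ring)
  field
    inv      : Carrier → Carrier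
    inv-cong : ∀ {x y} → x ≈ y → inv x ≈ inv y
    0≉1      : ¬ (0# ≈ 1#)
    inverseʳ : ∀ x → ¬ (x ≈ 0#) → x * inv x ≈ 1#
    charZero : ∀ n → ¬ (ringℕ commRing (suc n) ≈ 0#)

module FieldOps {c ℓ} (F : CharZeroField c ℓ) where
  open CharZeroField F

  fromℕ : ℕ → Carrier
  fromℕ = ringℕ commRing

  pow : Carrier → ℕ → Carrier
  pow x zero    = 1#
  pow x (suc n) = x * pow x n

  -- x / y  (only used with y ≉ 0)
  _÷_ : Carrier → Carrier → Carrier
  x ÷ y = x * inv y

  sumℕ : ℕ → (ℕ → Carrier) → Carrier
  sumℕ zero    f = 0#
  sumℕ (suc n) f = sumℕ n f + f n

  sumFin : ∀ n → (Fin n → Carrier) → Carrier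
  sumFin zero    f = 0#
  sumFin (suc n) f = f Fin.zero + sumFin n (λ j → f (Fin.suc j))

  charPoly : ℕ → Carrier → Carrier
  charPoly k x = pow x k - sumℕ k (λ i → pow x i)

  IsGenSeq : ℕ → Carrier → (ℕ → Carrier) → Set ℓ
  IsGenSeq k μ w =
    (∀ n → n ℕ.< k → w n ≈ pow μ n) ×
    (∀ n → k ℕ.≤ n → w n ≈ sumℕ k (λ i → w (n ℕ.∸ suc i)))

-- Write A x = (x - ζ j) q j x. A function of degree < k with k distinct roots vanishes identically,
-- so q j vanishes at the other roots but not at ζ j, and Lagrange interpolation gives
-- μ^n = Σ_j (q j μ / q j (ζ j)) ζ_j^n for n < k. The right-hand side satisfies the k-term recurrence
-- because every ζ_j is a root of A, and a solution of the recurrence is determined by its first k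
-- values; hence w n = Σ_j c_j ζ_j^n with c_j = q j μ / q j (ζ j). For the closed forms,
-- (μ - 1)(μ - ζ j) q j μ = (μ - 1) A μ = μ^{k+1} - 2μ^k + 1 =: B μ; comparing (x - 1) q j x with the
-- difference quotient of B at ζ j gives (ζ j - 1) q j (ζ j) = B'(ζ j) = ((k + 1) ζ j - 2k) ζ_j^{k-1};
-- and at μ = 1, q j 1 (ζ j - 1) = - A 1 = k - 1.
module Submission where

open import Defs
open import Level using (_⊔_)
open import Data.Nat using (ℕ; zero; suc; _≤_; _∸_; z≤n; s≤s) renaming (_*_ to _*ℕ_)
import Data.Nat.Base as ℕ
import Data.Nat.Properties as ℕ
open import Data.Nat.Induction using (<-rec)
open import Data.Integer.Base as ℤ using (ℤ; +_; -[1+_]; _⊖_; _◃_; sign; ∣_∣)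
import Data.Integer.Properties as ℤ
open import Data.Sign.Base as Sign using (Sign)
open import Data.Fin as Fin using (Fin)
import Data.Fin.Properties as Fin
open import Data.Product using (_×_; _,_; ∃-syntax; proj₁; proj₂)
open import Data.Maybe.Base as Maybe using (Maybe)
open import Data.Empty using (⊥-elim)
open import Function.Base using (_∘_)
open import Relation.Nullary using (¬_; yes; no)
open import Relation.Nullary.Decidable.Core using (dec⇒maybe)
open import Relation.Binary.PropositionalEquality as ≡ using (_≡_; _≢_)
open import Algebra.Bundles using (CommutativeRing)
open import Algebra.Solver.Ring.AlmostCommutativeRing
  using (_-Raw-AlmostCommutative⟶_; fromCommutativeRing)

module FieldTheory {c ℓ} (F : CharZeroField c ℓ) where
  open CharZeroField F
  open FieldOps F
  open import Algebra.Properties.Ring (CommutativeRing.ring commRing)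
    using (-1*x≈-x; x[y-z]≈xy-xz)
  open import Algebra.Properties.Group +-group
    using (ε⁻¹≈ε; ⁻¹-involutive; x∙y⁻¹≈ε⇒x≈y; x≈y⇒x∙y⁻¹≈ε) renaming (∙-cancelˡ to +-cancelˡ)
  open import Algebra.Properties.AbelianGroup +-abelianGroup using (⁻¹-∙-comm)
  open import Algebra.Properties.CommutativeSemigroup +-commutativeSemigroup
    using () renaming (interchange to +-interchange)
  open import Algebra.Properties.CommutativeSemigroup *-commutativeSemigroup
    using () renaming (interchange to *-interchange)
  open import Relation.Binary.Reasoning.Setoid setoid

  private variable
    m n : ℕ
    a b x y z : Carrier
    f g : Carrier → Carrier

  -- Integer coefficients for the ring solver

  x-0≈x : ∀ x → x - 0# ≈ x
  x-0≈x x = trans (+-congˡ ε⁻¹≈ε) (+-identityʳ x)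

  fromℕ-+ : ∀ m n → fromℕ (m ℕ.+ n) ≈ fromℕ m + fromℕ n
  fromℕ-+ zero    n = sym (+-identityˡ _)
  fromℕ-+ (suc m) n = trans (+-congˡ (fromℕ-+ m n)) (sym (+-assoc _ _ _))

  fromℕ-* : ∀ m n → fromℕ (m ℕ.* n) ≈ fromℕ m * fromℕ n
  fromℕ-* zero    n = sym (zeroˡ _)
  fromℕ-* (suc m) n = begin
    fromℕ (n ℕ.+ m ℕ.* n)             ≈⟨ fromℕ-+ n (m ℕ.* n) ⟩
    fromℕ n + fromℕ (m ℕ.* n)         ≈⟨ +-cong (sym (*-identityˡ _)) (fromℕ-* m n) ⟩
    1# * fromℕ n + fromℕ m * fromℕ n  ≈⟨ distribʳ _ _ _ ⟨
    (1# + fromℕ m) * fromℕ n          ∎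

  -- The clause for 1 makes the solver's constant con (+ 1) denote 1# itself.
  fromℤ : ℤ → Carrier
  fromℤ (+ 1)    = 1#
  fromℤ (+ n)    = fromℕ n
  fromℤ -[1+ n ] = - fromℕ (suc n)

  fromℤ-+ℕ : ∀ n → fromℤ (+ n) ≈ fromℕ n
  fromℤ-+ℕ zero          = refl
  fromℤ-+ℕ (suc zero)    = sym (+-identityʳ 1#)
  fromℤ-+ℕ (suc (suc n)) = refl

  fromℤ-⊖ : ∀ m n → fromℤ (m ⊖ n) ≈ fromℕ m - fromℕ n
  fromℤ-⊖ m       zero    = trans (fromℤ-+ℕ m) (sym (x-0≈x _))
  fromℤ-⊖ zero    (suc n) = sym (+-identityˡ _)
  fromℤ-⊖ (suc m) (suc n) = begin
    fromℤ (suc m ⊖ suc n)              ≡⟨ ≡.cong fromℤ (ℤ.[1+m]⊖[1+n]≡m⊖n m n) ⟩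
    fromℤ (m ⊖ n)                      ≈⟨ fromℤ-⊖ m n ⟩
    fromℕ m - fromℕ n                  ≈⟨ +-identityˡ _ ⟨
    0# + (fromℕ m - fromℕ n)           ≈⟨ +-congʳ (-‿inverseʳ 1#) ⟨
    (1# - 1#) + (fromℕ m - fromℕ n)    ≈⟨ +-interchange _ _ _ _ ⟩
    (1# + fromℕ m) + (- 1# - fromℕ n)  ≈⟨ +-congˡ (⁻¹-∙-comm 1# (fromℕ n)) ⟩
    (1# + fromℕ m) - (1# + fromℕ n)    ∎

  signed : Sign → Carrier
  signed Sign.+ = 1#
  signed Sign.- = - 1#

  signed-* : ∀ s t → signed (s Sign.* t) ≈ signed s * signed t
  signed-* Sign.+ t      = sym (*-identityˡ _)
  signed-* Sign.- Sign.+ = sym (*-identityʳ _)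
  signed-* Sign.- Sign.- = sym (trans (-1*x≈-x (- 1#)) (⁻¹-involutive 1#))

  fromℤ-◃ : ∀ s n → fromℤ (s ◃ n) ≈ signed s * fromℕ n
  fromℤ-◃ s      zero    = sym (zeroʳ _)
  fromℤ-◃ Sign.+ (suc n) = trans (fromℤ-+ℕ (suc n)) (sym (*-identityˡ _))
  fromℤ-◃ Sign.- (suc n) = sym (-1*x≈-x _)

  fromℤ≈signed*∣∣ : ∀ i → fromℤ i ≈ signed (sign i) * fromℕ ∣ i ∣
  fromℤ≈signed*∣∣ (+ n)    = trans (fromℤ-+ℕ n) (sym (*-identityˡ _))
  fromℤ≈signed*∣∣ -[1+ n ] = sym (-1*x≈-x _)

  fromℤ-+ : ∀ i j → fromℤ (i ℤ.+ j) ≈ fromℤ i + fromℤ j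
  fromℤ-+ (+ m) (+ n) = begin
    fromℤ (+ (m ℕ.+ n))      ≈⟨ fromℤ-+ℕ (m ℕ.+ n) ⟩
    fromℕ (m ℕ.+ n)          ≈⟨ fromℕ-+ m n ⟩
    fromℕ m + fromℕ n        ≈⟨ +-cong (fromℤ-+ℕ m) (fromℤ-+ℕ n) ⟨
    fromℤ (+ m) + fromℤ (+ n) ∎
  fromℤ-+ (+ m) -[1+ n ] = trans (fromℤ-⊖ m (suc n)) (+-congʳ (sym (fromℤ-+ℕ m)))
  fromℤ-+ -[1+ m ] (+ n) = trans (fromℤ-⊖ n (suc m)) (trans (+-comm _ _) (+-congˡ (sym (fromℤ-+ℕ n))))
  fromℤ-+ -[1+ m ] -[1+ n ] = begin
    - fromℕ (suc (suc (m ℕ.+ n)))      ≡⟨ ≡.cong (λ k → - fromℕ (suc k)) (ℕ.+-suc m n) ⟨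
    - fromℕ (suc m ℕ.+ suc n)          ≈⟨ -‿cong (fromℕ-+ (suc m) (suc n)) ⟩
    - (fromℕ (suc m) + fromℕ (suc n))  ≈⟨ ⁻¹-∙-comm _ _ ⟨
    - fromℕ (suc m) - fromℕ (suc n)    ∎

  fromℤ-* : ∀ i j → fromℤ (i ℤ.* j) ≈ fromℤ i * fromℤ j
  fromℤ-* i j = begin
    fromℤ ((s Sign.* t) ◃ (∣ i ∣ ℕ.* ∣ j ∣))
      ≈⟨ fromℤ-◃ (s Sign.* t) (∣ i ∣ ℕ.* ∣ j ∣) ⟩
    signed (s Sign.* t) * fromℕ (∣ i ∣ ℕ.* ∣ j ∣)
      ≈⟨ *-cong (signed-* s t) (fromℕ-* ∣ i ∣ ∣ j ∣) ⟩
    (signed s * signed t) * (fromℕ ∣ i ∣ * fromℕ ∣ j ∣)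
      ≈⟨ *-interchange _ _ _ _ ⟩
    (signed s * fromℕ ∣ i ∣) * (signed t * fromℕ ∣ j ∣)
      ≈⟨ *-cong (fromℤ≈signed*∣∣ i) (fromℤ≈signed*∣∣ j) ⟨
    fromℤ i * fromℤ j
      ∎
    where
    s t : Sign
    s = sign i
    t = sign j

  fromℤ-‿ : ∀ i → fromℤ (ℤ.- i) ≈ - fromℤ i
  fromℤ-‿ (+ zero)  = sym ε⁻¹≈ε
  fromℤ-‿ (+ suc n) = -‿cong (sym (fromℤ-+ℕ (suc n)))
  fromℤ-‿ -[1+ n ]  = trans (fromℤ-+ℕ (suc n)) (sym (⁻¹-involutive _))

  fromℤ-homomorphism : ℤ.+-*-rawRing -Raw-AlmostCommutative⟶ fromCommutativeRing commRing
  fromℤ-homomorphism = record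
    { ⟦_⟧    = fromℤ
    ; +-homo = fromℤ-+
    ; *-homo = fromℤ-*
    ; -‿homo = fromℤ-‿
    ; 0-homo = refl
    ; 1-homo = refl
    }

  fromℤ-≟ : ∀ i j → Maybe (fromℤ i ≈ fromℤ j)
  fromℤ-≟ i j = Maybe.map (reflexive ∘ ≡.cong fromℤ) (dec⇒maybe (i ℤ.≟ j))

  open import Algebra.Solver.Ring ℤ.+-*-rawRing (fromCommutativeRing commRing)
    fromℤ-homomorphism fromℤ-≟
    using (solve; _:=_; _:+_; _:*_; _:-_; :-_; con)

  x-y≈0⇒x≈y : x - y ≈ 0# → x ≈ y
  x-y≈0⇒x≈y = x∙y⁻¹≈ε⇒x≈y _ _

  xy≈0⇒y≈0 : x ≉ 0# → x * y ≈ 0# → y ≈ 0#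
  xy≈0⇒y≈0 {x} {y} x≉0 xy≈0 = begin
    y                ≈⟨ *-identityˡ y ⟨
    1# * y           ≈⟨ *-congʳ (trans (*-comm _ _) (inverseʳ x x≉0)) ⟨
    (inv x * x) * y  ≈⟨ *-assoc _ _ _ ⟩
    inv x * (x * y)  ≈⟨ *-congˡ xy≈0 ⟩
    inv x * 0#       ≈⟨ zeroʳ _ ⟩
    0#               ∎

  *-≉0 : x ≉ 0# → y ≉ 0# → x * y ≉ 0#
  *-≉0 x≉0 y≉0 xy≈0 = y≉0 (xy≈0⇒y≈0 x≉0 xy≈0)

  xy≉0⇒x≉0 : x * y ≉ 0# → x ≉ 0#
  xy≉0⇒x≉0 {y = y} xy≉0 x≈0 = xy≉0 (trans (*-congʳ x≈0) (zeroˡ y))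

  xy≉0⇒y≉0 : x * y ≉ 0# → y ≉ 0#
  xy≉0⇒y≉0 {x = x} xy≉0 y≈0 = xy≉0 (trans (*-congˡ y≈0) (zeroʳ x))

  xy≈1⇒y≈inv[x] : x * y ≈ 1# → y ≈ inv x
  xy≈1⇒y≈inv[x] {x} {y} xy≈1 = begin
    y                ≈⟨ *-identityʳ y ⟨
    y * 1#           ≈⟨ *-congˡ (inverseʳ x x≉0) ⟨
    y * (x * inv x)  ≈⟨ *-assoc _ _ _ ⟨
    (y * x) * inv x  ≈⟨ *-congʳ (trans (*-comm y x) xy≈1) ⟩
    1# * inv x       ≈⟨ *-identityˡ _ ⟩
    inv x            ∎
    where
    x≉0 : x ≉ 0#
    x≉0 x≈0 = 0≉1 (trans (sym (zeroˡ y)) (trans (*-congʳ (sym x≈0)) xy≈1))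

  ÷-unique : b ≉ 0# → b * x ≈ a → a ÷ b ≈ x
  ÷-unique {b} {x} {a} b≉0 bx≈a = begin
    a * inv b        ≈⟨ *-congʳ bx≈a ⟨
    (b * x) * inv b  ≈⟨ solve 3 (λ b x i → (b :* x) :* i := x :* (b :* i)) refl b x (inv b) ⟩
    x * (b * inv b)  ≈⟨ *-congˡ (inverseʳ b b≉0) ⟩
    x * 1#           ≈⟨ *-identityʳ x ⟩
    x                ∎

  fromℕ-injective : fromℕ m ≈ fromℕ n → m ≡ n
  fromℕ-injective {zero}  {zero}  _ = ≡.refl
  fromℕ-injective {zero}  {suc n} e = ⊥-elim (charZero n (sym e))
  fromℕ-injective {suc m} {zero}  e = ⊥-elim (charZero m e)
  fromℕ-injective {suc m} {suc n} e = ≡.cong suc (fromℕ-injective (+-cancelˡ 1# _ _ e))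

  pow-cong : ∀ n → x ≈ y → pow x n ≈ pow y n
  pow-cong zero    x≈y = refl
  pow-cong (suc n) x≈y = *-cong x≈y (pow-cong n x≈y)

  pow-+ : ∀ x m n → pow x (m ℕ.+ n) ≈ pow x m * pow x n
  pow-+ x zero    n = sym (*-identityˡ _)
  pow-+ x (suc m) n = trans (*-congˡ (pow-+ x m n)) (sym (*-assoc _ _ _))

  pow-1# : ∀ n → pow 1# n ≈ 1#
  pow-1# zero    = refl
  pow-1# (suc n) = trans (*-identityˡ _) (pow-1# n)

  sumℕ-cong : ∀ n {f g : ℕ → Carrier} → (∀ i → i ℕ.< n → f i ≈ g i) → sumℕ n f ≈ sumℕ n g
  sumℕ-cong zero    f≈g = refl
  sumℕ-cong (suc n) f≈g =
    +-cong (sumℕ-cong n (λ i i<n → f≈g i (ℕ.m<n⇒m<1+n i<n))) (f≈g n ℕ.≤-refl)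

  *-distribˡ-sumℕ : ∀ n a (f : ℕ → Carrier) → a * sumℕ n f ≈ sumℕ n (λ i → a * f i)
  *-distribˡ-sumℕ zero    a f = zeroʳ a
  *-distribˡ-sumℕ (suc n) a f = trans (distribˡ _ _ _) (+-congʳ (*-distribˡ-sumℕ n a f))

  sumℕ-const-1# : ∀ n → sumℕ n (λ _ → 1#) ≈ fromℕ n
  sumℕ-const-1# zero    = refl
  sumℕ-const-1# (suc n) = trans (+-congʳ (sumℕ-const-1# n)) (+-comm _ _)

  sumℕ-unfoldˡ : ∀ n (f : ℕ → Carrier) → sumℕ (suc n) f ≈ f 0 + sumℕ n (λ i → f (suc i))
  sumℕ-unfoldˡ zero    f = trans (+-identityˡ _) (sym (+-identityʳ _))
  sumℕ-unfoldˡ (suc n) f = trans (+-congʳ (sumℕ-unfoldˡ n f)) (+-assoc _ _ _)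

  sumℕ-reverse : ∀ n (f : ℕ → Carrier) → sumℕ n (λ i → f (n ∸ suc i)) ≈ sumℕ n f
  sumℕ-reverse zero    f = refl
  sumℕ-reverse (suc n) f = begin
    sumℕ n (λ i → f (suc n ∸ suc i)) + f (n ∸ n)
      ≈⟨ +-cong (sumℕ-cong n shift) (reflexive (≡.cong f (ℕ.n∸n≡0 n))) ⟩
    sumℕ n (λ i → f (suc (n ∸ suc i))) + f 0
      ≈⟨ +-congʳ (sumℕ-reverse n (f ∘ suc)) ⟩
    sumℕ n (λ i → f (suc i)) + f 0
      ≈⟨ +-comm _ _ ⟩
    f 0 + sumℕ n (λ i → f (suc i))
      ≈⟨ sumℕ-unfoldˡ n f ⟨
    sumℕ (suc n) f
      ∎
    where
    shift : ∀ i → i ℕ.< n → f (suc n ∸ suc i) ≈ f (suc (n ∸ suc i))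
    shift i i<n = reflexive (≡.cong f (ℕ.+-∸-assoc 1 i<n))

  sumFin-cong : ∀ n {f g : Fin n → Carrier} → (∀ j → f j ≈ g j) → sumFin n f ≈ sumFin n g
  sumFin-cong zero    f≈g = refl
  sumFin-cong (suc n) f≈g = +-cong (f≈g Fin.zero) (sumFin-cong n (f≈g ∘ Fin.suc))

  sumFin-+ : ∀ n (f g : Fin n → Carrier) →
             sumFin n (λ j → f j + g j) ≈ sumFin n f + sumFin n g
  sumFin-+ zero    f g = sym (+-identityˡ 0#)
  sumFin-+ (suc n) f g =
    trans (+-congˡ (sumFin-+ n (f ∘ Fin.suc) (g ∘ Fin.suc))) (+-interchange _ _ _ _)

  sumFin-≈0 : ∀ n {f : Fin n → Carrier} → (∀ j → f j ≈ 0#) → sumFin n f ≈ 0#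
  sumFin-≈0 zero    f≈0 = refl
  sumFin-≈0 (suc n) f≈0 =
    trans (+-cong (f≈0 Fin.zero) (sumFin-≈0 n (f≈0 ∘ Fin.suc))) (+-identityˡ 0#)

  sumFin-sumℕ : ∀ k n (h : Fin k → ℕ → Carrier) →
                sumFin k (λ j → sumℕ n (h j)) ≈ sumℕ n (λ i → sumFin k (λ j → h j i))
  sumFin-sumℕ k zero    h = sumFin-≈0 k (λ _ → refl)
  sumFin-sumℕ k (suc n) h = trans (sumFin-+ k _ _) (+-congʳ (sumFin-sumℕ k n h))

  sumFin-δ : ∀ n (f : Fin n → Carrier) (i : Fin n) → (∀ j → j ≢ i → f j ≈ 0#) → sumFin n f ≈ f i
  sumFin-δ (suc n) f Fin.zero    f≈0 =
    trans (+-congˡ (sumFin-≈0 n (λ j → f≈0 (Fin.suc j) λ ()))) (+-identityʳ _)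
  sumFin-δ (suc n) f (Fin.suc i) f≈0 =
    trans (+-cong (f≈0 Fin.zero λ ()) (sumFin-δ n (f ∘ Fin.suc) i f∘suc≈0)) (+-identityˡ _)
    where
    f∘suc≈0 : ∀ j → j ≢ i → f (Fin.suc j) ≈ 0#
    f∘suc≈0 j j≢i = f≈0 (Fin.suc j) (j≢i ∘ Fin.suc-injective)

  -- Polynomial functions

  -- Degree< avoids coefficients: the factor theorem serves as the definition.
  Degree< : ℕ → (Carrier → Carrier) → Set (c ⊔ ℓ)
  Degree< zero    f = ∀ x → f x ≈ 0#
  Degree< (suc m) f = ∀ a → ∃[ q ] Degree< m q × (∀ x → f x ≈ f a + (x - a) * q x)

  Degree<-cong : ∀ m → (∀ x → f x ≈ g x) → Degree< m f → Degree< m g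
  Degree<-cong zero    f≈g df x = trans (sym (f≈g x)) (df x)
  Degree<-cong (suc m) f≈g df a with df a
  ... | q , dq , f-factor =
    q , dq , λ x → trans (sym (f≈g x)) (trans (f-factor x) (+-congʳ (f≈g a)))

  Degree<-≈0 : ∀ m → (∀ x → f x ≈ 0#) → Degree< m f
  Degree<-≈0 zero    f≈0 = f≈0
  Degree<-≈0 (suc m) f≈0 a = (λ _ → 0#) , Degree<-≈0 m (λ _ → refl) ,
    λ x → trans (f≈0 x) (sym (trans (+-cong (f≈0 a) (zeroʳ _)) (+-identityˡ 0#)))

  Degree<-mono : m ℕ.≤ n → Degree< m f → Degree< n f
  Degree<-mono {n = n} ℕ.z≤n df = Degree<-≈0 n df
  Degree<-mono (ℕ.s≤s m≤n) df a with df a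
  ... | q , dq , f-factor = q , Degree<-mono m≤n dq , f-factor

  Degree<-+ : ∀ m → Degree< m f → Degree< m g → Degree< m (λ x → f x + g x)
  Degree<-+ zero    df dg x = trans (+-cong (df x) (dg x)) (+-identityʳ 0#)
  Degree<-+ {f} {g} (suc m) df dg a with df a | dg a
  ... | p , dp , f-factor | q , dq , g-factor = (λ x → p x + q x) , Degree<-+ m dp dq , λ x → begin
    f x + g x
      ≈⟨ +-cong (f-factor x) (g-factor x) ⟩
    (f a + (x - a) * p x) + (g a + (x - a) * q x)
      ≈⟨ solve 5 (λ fa ga d px qx → (fa :+ d :* px) :+ (ga :+ d :* qx) := (fa :+ ga) :+ d :* (px :+ qx))
                 refl (f a) (g a) (x - a) (p x) (q x) ⟩
    (f a + g a) + (x - a) * (p x + q x)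
      ∎

  Degree<-*ʳ : ∀ m b → Degree< m f → Degree< m (λ x → f x * b)
  Degree<-*ʳ zero    b df x = trans (*-congʳ (df x)) (zeroˡ b)
  Degree<-*ʳ {f} (suc m) b df a with df a
  ... | q , dq , f-factor = (λ x → q x * b) , Degree<-*ʳ m b dq , λ x → begin
    f x * b
      ≈⟨ *-congʳ (f-factor x) ⟩
    (f a + (x - a) * q x) * b
      ≈⟨ solve 4 (λ fa d qx b → (fa :+ d :* qx) :* b := fa :* b :+ d :* (qx :* b)) refl (f a) (x - a) (q x) b ⟩
    f a * b + (x - a) * (q x * b)
      ∎

  Degree<-sub : ∀ m → Degree< m f → Degree< m g → Degree< m (λ x → f x - g x)
  Degree<-sub m df dg =
    Degree<-+ m df (Degree<-cong m (λ x → trans (*-comm _ _) (-1*x≈-x _)) (Degree<-*ʳ m (- 1#) dg))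

  Degree<-linear* : ∀ m b → Degree< m f → Degree< (suc m) (λ x → (x - b) * f x)
  Degree<-linear* zero    b df = Degree<-≈0 1 (λ x → trans (*-congˡ (df x)) (zeroʳ _))
  Degree<-linear* {f} (suc m) b df a with df a
  ... | q , dq , f-factor = (λ x → f x + q x * (a - b)) ,
    Degree<-+ (suc m) df (Degree<-mono (ℕ.n≤1+n m) (Degree<-*ʳ m (a - b) dq)) , λ x → begin
      (x - b) * f x
        ≈⟨ *-congˡ (f-factor x) ⟩
      (x - b) * (f a + (x - a) * q x)
        ≈⟨ solve 5 (λ x a b fa qx → (x :- b) :* (fa :+ (x :- a) :* qx)
                                  := (a :- b) :* fa :+ (x :- a) :* ((fa :+ (x :- a) :* qx) :+ qx :* (a :- b)))
                   refl x a b (f a) (q x) ⟩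
      (a - b) * f a + (x - a) * ((f a + (x - a) * q x) + q x * (a - b))
        ≈⟨ +-congˡ (*-congˡ (+-congʳ (f-factor x))) ⟨
      (a - b) * f a + (x - a) * (f x + q x * (a - b))
        ∎

  Degree<-pow : ∀ n → Degree< (suc n) (λ x → pow x n)
  Degree<-pow zero    a =
    (λ _ → 0#) , (λ _ → refl) , λ x → sym (trans (+-congˡ (zeroʳ _)) (+-identityʳ 1#))
  Degree<-pow (suc n) =
    Degree<-cong (suc (suc n)) (λ x → *-congʳ (x-0≈x x)) (Degree<-linear* (suc n) 0# (Degree<-pow n))

  Degree<-sumℕ : ∀ m n (f : ℕ → Carrier → Carrier) → (∀ i → i ℕ.< n → Degree< m (f i)) →
                 Degree< m (λ x → sumℕ n (λ i → f i x))
  Degree<-sumℕ m zero    f df = Degree<-≈0 m (λ _ → refl)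
  Degree<-sumℕ m (suc n) f df =
    Degree<-+ m (Degree<-sumℕ m n f (λ i i<n → df i (ℕ.m<n⇒m<1+n i<n))) (df n ℕ.≤-refl)

  Degree<-sumFin : ∀ m n (f : Fin n → Carrier → Carrier) → (∀ j → Degree< m (f j)) →
                   Degree< m (λ x → sumFin n (λ j → f j x))
  Degree<-sumFin m zero    f df = Degree<-≈0 m (λ _ → refl)
  Degree<-sumFin m (suc n) f df =
    Degree<-+ m (df Fin.zero) (Degree<-sumFin m n (f ∘ Fin.suc) (df ∘ Fin.suc))

  Distinct : ∀ {n} → (Fin n → Carrier) → Set ℓ
  Distinct r = ∀ i j → r i ≈ r j → i ≡ j

  Degree<-roots⇒≈0 : ∀ m → Degree< m f → (r : Fin m → Carrier) → Distinct r →
                     (∀ i → f (r i) ≈ 0#) → ∀ x → f x ≈ 0#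
  Degree<-roots⇒≈0 zero    df r r-distinct f∘r≈0 = df
  Degree<-roots⇒≈0 {f} (suc m) df r r-distinct f∘r≈0 x with df (r Fin.zero)
  ... | q , dq , f-factor = begin
    f x                    ≈⟨ f-factor x ⟩
    f r₀ + (x - r₀) * q x  ≈⟨ +-cong (f∘r≈0 Fin.zero) (*-congˡ (q≈0 x)) ⟩
    0# + (x - r₀) * 0#     ≈⟨ trans (+-identityˡ _) (zeroʳ _) ⟩
    0#                     ∎
    where
    r₀ : Carrier
    r₀ = r Fin.zero
    q∘r≈0 : ∀ i → q (r (Fin.suc i)) ≈ 0#
    q∘r≈0 i = xy≈0⇒y≈0 (λ e → Fin.0≢1+n (r-distinct _ _ (sym (x-y≈0⇒x≈y e)))) (begin
      (rᵢ - r₀) * q rᵢ         ≈⟨ +-identityˡ _ ⟨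
      0# + (rᵢ - r₀) * q rᵢ    ≈⟨ +-congʳ (f∘r≈0 Fin.zero) ⟨
      f r₀ + (rᵢ - r₀) * q rᵢ  ≈⟨ f-factor rᵢ ⟨
      f rᵢ                     ≈⟨ f∘r≈0 (Fin.suc i) ⟩
      0#                       ∎)
      where
      rᵢ : Carrier
      rᵢ = r (Fin.suc i)
    q≈0 : ∀ x → q x ≈ 0#
    q≈0 = Degree<-roots⇒≈0 m dq (r ∘ Fin.suc) (λ i j e → Fin.suc-injective (r-distinct _ _ e)) q∘r≈0

  Degree<-cancel-linear : ∀ m → Degree< m f → Degree< m g →
                          (∀ x → (x - z) * f x ≈ (x - z) * g x) → ∀ x → f x ≈ g x
  Degree<-cancel-linear {f} {g} {z} m df dg f≈g-off-z x =
    x-y≈0⇒x≈y (Degree<-roots⇒≈0 m (Degree<-sub m df dg) r r-distinct f-g∘r≈0 x)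
    where
    -- in characteristic zero, z + 1, …, z + m are m distinct points other than z
    r : Fin m → Carrier
    r i = z + fromℕ (suc (Fin.toℕ i))
    r-z : ∀ i → r i - z ≈ fromℕ (suc (Fin.toℕ i))
    r-z i = solve 2 (λ z d → (z :+ d) :- z := d) refl z _
    r-distinct : Distinct r
    r-distinct i j e = Fin.toℕ-injective (ℕ.suc-injective (fromℕ-injective (+-cancelˡ z _ _ e)))
    f-g∘r≈0 : ∀ i → f (r i) - g (r i) ≈ 0#
    f-g∘r≈0 i = xy≈0⇒y≈0 (λ e → charZero (Fin.toℕ i) (trans (sym (r-z i)) e)) (begin
      (r i - z) * (f (r i) - g (r i))            ≈⟨ x[y-z]≈xy-xz _ _ _ ⟩
      (r i - z) * f (r i) - (r i - z) * g (r i)  ≈⟨ x≈y⇒x∙y⁻¹≈ε (f≈g-off-z (r i)) ⟩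
      0#                                         ∎)

  interpolation : ∀ n (ζ : Fin n → Carrier) → Distinct ζ → (L : Fin n → Carrier → Carrier) →
                  (∀ j → Degree< n (L j)) → (∀ i j → j ≢ i → L j (ζ i) ≈ 0#) →
                  (∀ j → L j (ζ j) ≈ 1#) →
                  Degree< n f → ∀ x → f x ≈ sumFin n (λ j → L j x * f (ζ j))
  interpolation {f} n ζ ζ-distinct L dL L-off L-diag df x =
    sym (x-y≈0⇒x≈y (Degree<-roots⇒≈0 n dP ζ ζ-distinct P∘ζ≈0 x))
    where
    P : Carrier → Carrier
    P x = sumFin n (λ j → L j x * f (ζ j)) - f x
    dP : Degree< n P
    dP = Degree<-sub n (Degree<-sumFin n n _ (λ j → Degree<-*ʳ n (f (ζ j)) (dL j))) df
    P∘ζ≈0 : ∀ i → P (ζ i) ≈ 0#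
    P∘ζ≈0 i = x≈y⇒x∙y⁻¹≈ε (begin
      sumFin n (λ j → L j (ζ i) * f (ζ j))
        ≈⟨ sumFin-δ n _ i (λ j j≢i → trans (*-congʳ (L-off i j j≢i)) (zeroˡ _)) ⟩
      L i (ζ i) * f (ζ i)
        ≈⟨ trans (*-congʳ (L-diag i)) (*-identityˡ _) ⟩
      f (ζ i)
        ∎)

  -- Linear recurrences

  SatisfiesRecurrence : ℕ → (ℕ → Carrier) → Set ℓ
  SatisfiesRecurrence k v = ∀ n → k ℕ.≤ n → v n ≈ sumℕ k (λ i → v (n ∸ suc i))

  recurrence-unique : ∀ k {v w : ℕ → Carrier} → SatisfiesRecurrence k v → SatisfiesRecurrence k w →
                      (∀ n → n ℕ.< k → v n ≈ w n) → ∀ n → v n ≈ w n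
  recurrence-unique k {v} {w} v-rec w-rec v≈w-initially = <-rec _ step
    where
    step : ∀ n → (∀ {m} → m ℕ.< n → v m ≈ w m) → v n ≈ w n
    step n v≈w-below with k ℕ.≤? n
    ... | no  k≰n = v≈w-initially n (ℕ.≰⇒> k≰n)
    ... | yes k≤n = begin
      v n                           ≈⟨ v-rec n k≤n ⟩
      sumℕ k (λ i → v (n ∸ suc i))  ≈⟨ sumℕ-cong k (λ i i<k → v≈w-below (n∸1+i<n i<k)) ⟩
      sumℕ k (λ i → w (n ∸ suc i))  ≈⟨ w-rec n k≤n ⟨
      w n                           ∎
      where
      n∸1+i<n : ∀ {i} → i ℕ.< k → n ∸ suc i ℕ.< n
      n∸1+i<n i<k = ℕ.∸-monoʳ-< ℕ.z<s (ℕ.≤-trans i<k k≤n)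

  pow-recurrence : ∀ k → charPoly k z ≈ 0# → SatisfiesRecurrence k (pow z)
  pow-recurrence {z} k Az≈0 n k≤n = begin
    pow z n                                     ≡⟨ ≡.cong (pow z) n≡d+k ⟩
    pow z (d ℕ.+ k)                             ≈⟨ pow-+ z d k ⟩
    pow z d * pow z k                           ≈⟨ *-congˡ (x-y≈0⇒x≈y Az≈0) ⟩
    pow z d * sumℕ k (pow z)                    ≈⟨ *-congˡ (sumℕ-reverse k (pow z)) ⟨
    pow z d * sumℕ k (λ i → pow z (k ∸ suc i))  ≈⟨ *-distribˡ-sumℕ k (pow z d) _ ⟩
    sumℕ k (λ i → pow z d * pow z (k ∸ suc i))  ≈⟨ sumℕ-cong k (λ i i<k → sym (exponent i i<k)) ⟩
    sumℕ k (λ i → pow z (n ∸ suc i))            ∎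
    where
    d : ℕ
    d = n ∸ k
    n≡d+k : n ≡ d ℕ.+ k
    n≡d+k = ≡.sym (ℕ.m∸n+n≡m k≤n)
    exponent : ∀ i → i ℕ.< k → pow z (n ∸ suc i) ≈ pow z d * pow z (k ∸ suc i)
    exponent i i<k = begin
      pow z (n ∸ suc i)              ≡⟨ ≡.cong (λ e → pow z (e ∸ suc i)) n≡d+k ⟩
      pow z (d ℕ.+ k ∸ suc i)        ≡⟨ ≡.cong (pow z) (ℕ.+-∸-assoc d i<k) ⟩
      pow z (d ℕ.+ (k ∸ suc i))      ≈⟨ pow-+ z d (k ∸ suc i) ⟩
      pow z d * pow z (k ∸ suc i)    ∎

  powerSum : ∀ {k} → (Fin k → Carrier) → (Fin k → Carrier) → ℕ → Carrier
  powerSum {k} ζ C n = sumFin k (λ j → C j * pow (ζ j) n)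

  powerSum-cong : ∀ {k} (ζ : Fin k → Carrier) {C C′} → (∀ j → C j ≈ C′ j) →
                  ∀ n → powerSum ζ C n ≈ powerSum ζ C′ n
  powerSum-cong {k} ζ C≈C′ n = sumFin-cong k (λ j → *-congʳ (C≈C′ j))

  powerSum-recurrence : ∀ k (ζ : Fin k → Carrier) → (∀ j → charPoly k (ζ j) ≈ 0#) →
                        ∀ C → SatisfiesRecurrence k (powerSum ζ C)
  powerSum-recurrence k ζ roots C n k≤n = begin
    sumFin k (λ j → C j * pow (ζ j) n)
      ≈⟨ sumFin-cong k (λ j → *-congˡ (pow-recurrence k (roots j) n k≤n)) ⟩
    sumFin k (λ j → C j * sumℕ k (λ i → pow (ζ j) (n ∸ suc i)))
      ≈⟨ sumFin-cong k (λ j → *-distribˡ-sumℕ k (C j) _) ⟩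
    sumFin k (λ j → sumℕ k (λ i → C j * pow (ζ j) (n ∸ suc i)))
      ≈⟨ sumFin-sumℕ k k _ ⟩
    sumℕ k (λ i → powerSum ζ C (n ∸ suc i))
      ∎

  IsGenSeq⇒powerSum : ∀ k (ζ : Fin k → Carrier) → (∀ j → charPoly k (ζ j) ≈ 0#) →
                      ∀ {μ w} → IsGenSeq k μ w →
                      ∀ C → (∀ n → n ℕ.< k → pow μ n ≈ powerSum ζ C n) →
                      ∀ n → w n ≈ powerSum ζ C n
  IsGenSeq⇒powerSum k ζ roots (w-initial , w-rec) C μⁿ≈powerSum =
    recurrence-unique k w-rec (powerSum-recurrence k ζ roots C)
      (λ n n<k → trans (w-initial n n<k) (μⁿ≈powerSum n n<k))

  -- The characteristic polynomial and its sparse multiple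

  geometric-sum : ∀ n x → (x - 1#) * sumℕ n (pow x) ≈ pow x n - 1#
  geometric-sum zero    x = trans (zeroʳ _) (sym (-‿inverseʳ 1#))
  geometric-sum (suc n) x = begin
    (x - 1#) * (sumℕ n (pow x) + pow x n)
      ≈⟨ distribˡ _ _ _ ⟩
    (x - 1#) * sumℕ n (pow x) + (x - 1#) * pow x n
      ≈⟨ +-congʳ (geometric-sum n x) ⟩
    (pow x n - 1#) + (x - 1#) * pow x n
      ≈⟨ solve 2 (λ p x → (p :- con (+ 1)) :+ (x :- con (+ 1)) :* p := x :* p :- con (+ 1)) refl (pow x n) x ⟩
    x * pow x n - 1#
      ∎

  charPoly-1# : ∀ n → charPoly (suc n) 1# ≈ - fromℕ n
  charPoly-1# n = begin
    pow 1# (suc n) - sumℕ (suc n) (pow 1#)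
      ≈⟨ +-cong (pow-1# (suc n))
                (-‿cong (trans (sumℕ-cong (suc n) (λ i _ → pow-1# i)) (sumℕ-const-1# (suc n)))) ⟩
    1# - (1# + fromℕ n)
      ≈⟨ solve 1 (λ a → con (+ 1) :- (con (+ 1) :+ a) := :- a) refl (fromℕ n) ⟩
    - fromℕ n
      ∎

  Degree<-charPoly : ∀ k → Degree< (suc k) (charPoly k)
  Degree<-charPoly k = Degree<-sub (suc k) (Degree<-pow k) (Degree<-sumℕ (suc k) k (λ i x → pow x i)
    (λ i i<k → Degree<-mono (ℕ.s≤s (ℕ.<⇒≤ i<k)) (Degree<-pow i)))

  sparseCharPoly : ℕ → Carrier → Carrier
  sparseCharPoly k x = pow x (suc k) - fromℕ 2 * pow x k + 1#

  sparseCharPoly≈[x-1]charPoly : ∀ k x → sparseCharPoly k x ≈ (x - 1#) * charPoly k x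
  sparseCharPoly≈[x-1]charPoly k x = sym (begin
    (x - 1#) * (pow x k - sumℕ k (pow x))
      ≈⟨ x[y-z]≈xy-xz _ _ _ ⟩
    (x - 1#) * pow x k - (x - 1#) * sumℕ k (pow x)
      ≈⟨ +-congˡ (-‿cong (geometric-sum k x)) ⟩
    (x - 1#) * pow x k - (pow x k - 1#)
      ≈⟨ solve 2 (λ x p → (x :- con (+ 1)) :* p :- (p :- con (+ 1)) := x :* p :- con (+ 2) :* p :+ con (+ 1))
                 refl x (pow x k) ⟩
    sparseCharPoly k x
      ∎)

  powQuotient : Carrier → ℕ → Carrier → Carrier
  powQuotient z zero    x = 0#
  powQuotient z (suc n) x = pow x n + powQuotient z n x * z

  pow-pow≈[x-z]*powQuotient : ∀ n → pow x n - pow z n ≈ (x - z) * powQuotient z n x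
  pow-pow≈[x-z]*powQuotient zero    = trans (-‿inverseʳ 1#) (sym (zeroʳ _))
  pow-pow≈[x-z]*powQuotient {x} {z} (suc n) = begin
    x * pow x n - z * pow z n
      ≈⟨ solve 4 (λ x z p q → x :* p :- z :* q := (x :- z) :* p :+ (p :- q) :* z) refl x z (pow x n) (pow z n) ⟩
    (x - z) * pow x n + (pow x n - pow z n) * z
      ≈⟨ +-congˡ (*-congʳ (pow-pow≈[x-z]*powQuotient n)) ⟩
    (x - z) * pow x n + ((x - z) * powQuotient z n x) * z
      ≈⟨ solve 4 (λ d p s z → d :* p :+ (d :* s) :* z := d :* (p :+ s :* z)) refl (x - z) (pow x n) _ z ⟩
    (x - z) * (pow x n + powQuotient z n x * z)
      ∎

  powQuotient-diag : ∀ n → powQuotient z (suc n) z ≈ fromℕ (suc n) * pow z n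
  powQuotient-diag {z} zero    = trans (+-congˡ (zeroˡ z)) (sym (*-identityʳ _))
  powQuotient-diag {z} (suc n) = begin
    z * pow z n + powQuotient z (suc n) z * z
      ≈⟨ +-congˡ (*-congʳ (powQuotient-diag n)) ⟩
    z * pow z n + (fromℕ (suc n) * pow z n) * z
      ≈⟨ solve 3 (λ z p a → z :* p :+ (a :* p) :* z := (con (+ 1) :+ a) :* (z :* p)) refl z (pow z n) _ ⟩
    (1# + fromℕ (suc n)) * (z * pow z n)
      ∎

  Degree<-powQuotient : ∀ n → Degree< n (powQuotient z n)
  Degree<-powQuotient     zero    _ = refl
  Degree<-powQuotient {z} (suc n)   = Degree<-+ (suc n) (Degree<-pow n)
    (Degree<-mono (ℕ.n≤1+n n) (Degree<-*ʳ n z (Degree<-powQuotient n)))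

  sparseQuotient : ℕ → Carrier → Carrier → Carrier
  sparseQuotient k z x = powQuotient z (suc k) x - powQuotient z k x * fromℕ 2

  sparseCharPoly-factor : ∀ k → sparseCharPoly k x - sparseCharPoly k z ≈ (x - z) * sparseQuotient k z x
  sparseCharPoly-factor {x} {z} k = begin
    sparseCharPoly k x - sparseCharPoly k z
      ≈⟨ solve 5 (λ x₁ z₁ x₀ z₀ t → ((x₁ :- t :* x₀) :+ con (+ 1)) :- ((z₁ :- t :* z₀) :+ con (+ 1))
                                  := (x₁ :- z₁) :- (x₀ :- z₀) :* t)
                 refl (pow x (suc k)) (pow z (suc k)) (pow x k) (pow z k) (fromℕ 2) ⟩
    (pow x (suc k) - pow z (suc k)) - (pow x k - pow z k) * fromℕ 2
      ≈⟨ +-cong (pow-pow≈[x-z]*powQuotient (suc k)) (-‿cong (*-congʳ (pow-pow≈[x-z]*powQuotient k))) ⟩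
    (x - z) * powQuotient z (suc k) x - ((x - z) * powQuotient z k x) * fromℕ 2
      ≈⟨ solve 4 (λ d s₁ s₀ t → d :* s₁ :- (d :* s₀) :* t := d :* (s₁ :- s₀ :* t))
                 refl (x - z) _ _ (fromℕ 2) ⟩
    (x - z) * sparseQuotient k z x
      ∎

  sparseQuotient-diag : ∀ n → sparseQuotient (suc n) z z ≈
                              (fromℕ (2 ℕ.+ n) * z - fromℕ (2 ℕ.* suc n)) * pow z n
  sparseQuotient-diag {z} n = begin
    powQuotient z (2 ℕ.+ n) z - powQuotient z (suc n) z * fromℕ 2
      ≈⟨ +-cong (powQuotient-diag (suc n)) (-‿cong (*-congʳ (powQuotient-diag n))) ⟩
    fromℕ (2 ℕ.+ n) * (z * pow z n) - (fromℕ (suc n) * pow z n) * fromℕ 2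
      ≈⟨ solve 5 (λ a z p b t → a :* (z :* p) :- (b :* p) :* t := (a :* z :- t :* b) :* p)
                 refl (fromℕ (2 ℕ.+ n)) z (pow z n) (fromℕ (suc n)) (fromℕ 2) ⟩
    (fromℕ (2 ℕ.+ n) * z - fromℕ 2 * fromℕ (suc n)) * pow z n
      ≈⟨ *-congʳ (+-congˡ (-‿cong (fromℕ-* 2 (suc n)))) ⟨
    (fromℕ (2 ℕ.+ n) * z - fromℕ (2 ℕ.* suc n)) * pow z n
      ∎

  Degree<-sparseQuotient : ∀ k → Degree< (suc k) (sparseQuotient k z)
  Degree<-sparseQuotient {z} k = Degree<-sub (suc k) (Degree<-powQuotient (suc k))
    (Degree<-mono (ℕ.n≤1+n k) (Degree<-*ʳ k (fromℕ 2) (Degree<-powQuotient k)))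

  -- The roots of the characteristic polynomial

  module Roots (m : ℕ) (ζ : Fin (2 ℕ.+ m) → Carrier)
               (roots : ∀ j → charPoly (2 ℕ.+ m) (ζ j) ≈ 0#) (ζ-distinct : Distinct ζ) where

    k : ℕ
    k = 2 ℕ.+ m

    -- q j x = charPoly k x / (x - ζ j)
    q : Fin k → Carrier → Carrier
    q j = proj₁ (Degree<-charPoly k (ζ j))

    Degree<-q : ∀ j → Degree< k (q j)
    Degree<-q j = proj₁ (proj₂ (Degree<-charPoly k (ζ j)))

    charPoly-factor : ∀ j x → charPoly k x ≈ (x - ζ j) * q j x
    charPoly-factor j x = trans (proj₂ (proj₂ (Degree<-charPoly k (ζ j))) x)
                                (trans (+-congʳ (roots j)) (+-identityˡ _))

    q-off-diag : ∀ i j → j ≢ i → q j (ζ i) ≈ 0#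
    q-off-diag i j j≢i = xy≈0⇒y≈0 (λ e → j≢i (≡.sym (ζ-distinct i j (x-y≈0⇒x≈y e))))
                                  (trans (sym (charPoly-factor j (ζ i))) (roots i))

    q-at-1# : ∀ j → q j 1# * (ζ j - 1#) ≈ fromℕ (suc m)
    q-at-1# j = begin
      q j 1# * (ζ j - 1#)
        ≈⟨ solve 2 (λ a z → a :* (z :- con (+ 1)) := :- ((con (+ 1) :- z) :* a)) refl (q j 1#) (ζ j) ⟩
      - ((1# - ζ j) * q j 1#)
        ≈⟨ -‿cong (trans (sym (charPoly-factor j 1#)) (charPoly-1# (suc m))) ⟩
      - - fromℕ (suc m)
        ≈⟨ ⁻¹-involutive _ ⟩
      fromℕ (suc m)
        ∎

    ζ-1≉0 : ∀ j → ζ j - 1# ≉ 0#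
    ζ-1≉0 j = xy≉0⇒y≉0 (λ e → charZero m (trans (sym (q-at-1# j)) e))

    -- otherwise q j would vanish at all k roots, hence everywhere, in particular at 1
    q-diag≉0 : ∀ j → q j (ζ j) ≉ 0#
    q-diag≉0 j qζ≈0 = charZero m (begin
      fromℕ (suc m)        ≈⟨ q-at-1# j ⟨
      q j 1# * (ζ j - 1#)  ≈⟨ *-congʳ (Degree<-roots⇒≈0 k (Degree<-q j) ζ ζ-distinct q∘ζ≈0 1#) ⟩
      0# * (ζ j - 1#)      ≈⟨ zeroˡ _ ⟩
      0#                   ∎)
      where
      q∘ζ≈0 : ∀ i → q j (ζ i) ≈ 0#
      q∘ζ≈0 i with j Fin.≟ i
      ... | yes ≡.refl = qζ≈0
      ... | no  j≢i    = q-off-diag i j j≢i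

    D : Fin k → Carrier
    D j = fromℕ (suc k) * ζ j - fromℕ (2 ℕ.* k)

    -- both sides are the derivative of sparseCharPoly k at ζ j
    q-diag : ∀ j → (ζ j - 1#) * q j (ζ j) ≈ D j * pow (ζ j) (k ∸ 1)
    q-diag j = trans (Degree<-cancel-linear (suc k) (Degree<-linear* k 1# (Degree<-q j))
                                            (Degree<-sparseQuotient k) agree (ζ j))
                     (sparseQuotient-diag (suc m))
      where
      B : Carrier → Carrier
      B = sparseCharPoly k
      Bζ≈0 : B (ζ j) ≈ 0#
      Bζ≈0 = trans (sparseCharPoly≈[x-1]charPoly k (ζ j)) (trans (*-congˡ (roots j)) (zeroʳ _))
      agree : ∀ x → (x - ζ j) * ((x - 1#) * q j x) ≈ (x - ζ j) * sparseQuotient k (ζ j) x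
      agree x = begin
        (x - ζ j) * ((x - 1#) * q j x)
          ≈⟨ solve 3 (λ d e a → d :* (e :* a) := e :* (d :* a)) refl (x - ζ j) (x - 1#) (q j x) ⟩
        (x - 1#) * ((x - ζ j) * q j x)        ≈⟨ *-congˡ (charPoly-factor j x) ⟨
        (x - 1#) * charPoly k x               ≈⟨ sparseCharPoly≈[x-1]charPoly k x ⟨
        B x                                   ≈⟨ x-0≈x (B x) ⟨
        B x - 0#                              ≈⟨ +-congˡ (-‿cong Bζ≈0) ⟨
        B x - B (ζ j)                         ≈⟨ sparseCharPoly-factor k ⟩
        (x - ζ j) * sparseQuotient k (ζ j) x  ∎

    lagrangeBasis : Fin k → Carrier → Carrier
    lagrangeBasis j x = q j x * inv (q j (ζ j))

    pow-interpolation : ∀ x {n} → n ℕ.< k → pow x n ≈ powerSum ζ (λ j → lagrangeBasis j x) n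
    pow-interpolation x {n} n<k = interpolation k ζ ζ-distinct lagrangeBasis
      (λ j → Degree<-*ʳ k _ (Degree<-q j))
      (λ i j j≢i → trans (*-congʳ (q-off-diag i j j≢i)) (zeroˡ _))
      (λ j → inverseʳ _ (q-diag≉0 j))
      (Degree<-mono n<k (Degree<-pow n)) x

    inv-q-diag : ∀ j → ((ζ j - 1#) ÷ D j) * (1# ÷ pow (ζ j) (k ∸ 1)) ≈ inv (q j (ζ j))
    inv-q-diag j = xy≈1⇒y≈inv[x] (begin
      q j (ζ j) * (((ζ j - 1#) * inv (D j)) * (1# * inv Z))
        ≈⟨ solve 4 (λ a b d z → a :* ((b :* d) :* (con (+ 1) :* z)) := (b :* a) :* (d :* z))
                   refl (q j (ζ j)) (ζ j - 1#) (inv (D j)) (inv Z) ⟩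
      ((ζ j - 1#) * q j (ζ j)) * (inv (D j) * inv Z)  ≈⟨ *-congʳ (q-diag j) ⟩
      (D j * Z) * (inv (D j) * inv Z)                 ≈⟨ *-interchange _ _ _ _ ⟩
      (D j * inv (D j)) * (Z * inv Z)
        ≈⟨ *-cong (inverseʳ _ (xy≉0⇒x≉0 DZ≉0)) (inverseʳ _ (xy≉0⇒y≉0 DZ≉0)) ⟩
      1# * 1#                                         ≈⟨ *-identityˡ 1# ⟩
      1#                                              ∎)
      where
      Z : Carrier
      Z = pow (ζ j) (k ∸ 1)
      DZ≉0 : D j * Z ≉ 0#
      DZ≉0 DZ≈0 = *-≉0 (ζ-1≉0 j) (q-diag≉0 j) (trans (q-diag j) DZ≈0)

    cᵢ : Carrier → Fin k → Carrier
    cᵢ μ j = ((sparseCharPoly k μ ÷ ((μ - 1#) * (μ - ζ j))) * ((ζ j - 1#) ÷ D j))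
             * (1# ÷ pow (ζ j) (k ∸ 1))

    cᵢᵢ : Fin k → Carrier
    cᵢᵢ j = (fromℕ (k ∸ 1) ÷ D j) * (1# ÷ pow (ζ j) (k ∸ 1))

    cᵢ≈lagrangeBasis : ∀ {μ} → μ ≉ 1# → charPoly k μ ≉ 0# → ∀ j → cᵢ μ j ≈ lagrangeBasis j μ
    cᵢ≈lagrangeBasis {μ} μ≉1 Aμ≉0 j =
      trans (*-assoc _ _ _) (*-cong (÷-unique M≉0 Mq≈B) (inv-q-diag j))
      where
      M : Carrier
      M = (μ - 1#) * (μ - ζ j)
      M≉0 : M ≉ 0#
      M≉0 = *-≉0 (μ≉1 ∘ x-y≈0⇒x≈y)
                 (λ e → Aμ≉0 (trans (charPoly-factor j μ) (trans (*-congʳ e) (zeroˡ _))))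
      Mq≈B : M * q j μ ≈ sparseCharPoly k μ
      Mq≈B = trans (*-assoc _ _ _)
                   (trans (*-congˡ (sym (charPoly-factor j μ))) (sym (sparseCharPoly≈[x-1]charPoly k μ)))

    cᵢᵢ≈lagrangeBasis : ∀ j → cᵢᵢ j ≈ lagrangeBasis j 1#
    cᵢᵢ≈lagrangeBasis j = begin
      (fromℕ (suc m) * inv (D j)) * (1# ÷ Z)          ≈⟨ *-congʳ (*-congʳ (q-at-1# j)) ⟨
      ((q j 1# * (ζ j - 1#)) * inv (D j)) * (1# ÷ Z)  ≈⟨ *-congʳ (*-assoc _ _ _) ⟩
      (q j 1# * ((ζ j - 1#) * inv (D j))) * (1# ÷ Z)  ≈⟨ *-assoc _ _ _ ⟩
      q j 1# * (((ζ j - 1#) ÷ D j) * (1# ÷ Z))        ≈⟨ *-congˡ (inv-q-diag j) ⟩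
      lagrangeBasis j 1#                              ∎
      where
      Z : Carrier
      Z = pow (ζ j) (k ∸ 1)

mainTheorem3 : ∀ {c ℓ} (F : CharZeroField c ℓ) →
    let open CharZeroField F
        open FieldOps F
    in (k : ℕ) → 2 ≤ k →
       (ζ : Fin k → Carrier) →
       (∀ j → charPoly k (ζ j) ≈ 0#) →
       (∀ i j → ζ i ≈ ζ j → i ≡ j) →
       (μ : Carrier) → (w : ℕ → Carrier) → IsGenSeq k μ w →
       ((¬ (μ ≈ 1#) → ¬ (charPoly k μ ≈ 0#) → ∀ n →
          w n ≈ sumFin k (λ j →
            (((pow μ (suc k) - fromℕ 2 * pow μ k + 1#) ÷ ((μ - 1#) * (μ - ζ j)))
             * ((ζ j - 1#) ÷ (fromℕ (suc k) * ζ j - fromℕ (2 *ℕ k)))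
             * (1# ÷ pow (ζ j) (k ∸ 1)))
            * pow (ζ j) n))
       ×
       (μ ≈ 1# → ∀ n →
          w n ≈ sumFin k (λ j →
            ((fromℕ (k ∸ 1) ÷ (fromℕ (suc k) * ζ j - fromℕ (2 *ℕ k)))
             * (1# ÷ pow (ζ j) (k ∸ 1)))
            * pow (ζ j) n)))
mainTheorem3 F (suc (suc m)) (s≤s (s≤s z≤n)) ζ roots ζ-distinct μ w w-gen =
  (λ μ≉1 Aμ≉0 → IsGenSeq⇒powerSum k ζ roots w-gen (cᵢ μ) λ n n<k → begin
     pow μ n                                   ≈⟨ pow-interpolation μ n<k ⟩
     powerSum ζ (λ j → lagrangeBasis j μ) n    ≈⟨ powerSum-cong ζ (cᵢ≈lagrangeBasis μ≉1 Aμ≉0) n ⟨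
     powerSum ζ (cᵢ μ) n                       ∎) ,
  (λ μ≈1 → IsGenSeq⇒powerSum k ζ roots w-gen cᵢᵢ λ n n<k → begin
     pow μ n                                   ≈⟨ pow-cong n μ≈1 ⟩
     pow 1# n                                  ≈⟨ pow-interpolation 1# n<k ⟩
     powerSum ζ (λ j → lagrangeBasis j 1#) n   ≈⟨ powerSum-cong ζ cᵢᵢ≈lagrangeBasis n ⟨
     powerSum ζ cᵢᵢ n                          ∎)
  where
  open CharZeroField F
  open FieldOps F
  open FieldTheory F
  open Roots m ζ roots ζ-distinct
  open import Relation.Binary.Reasoning.Setoid setoid
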